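{- Let $b\geq 3$ be an integer and set $n=b^2$, $k=\lfloor b-b^{9/10}\rfloor$, $N=n^2k$ and $\ell=n-bk$. Let $S$ be a Latin square of order $n$ over the alphabet $[n]$, and fix $\ell$ pairwise disjoint transversals of $S$; call the positions of $S$ lying in these $\ell$ transversals special. Let $A_1,\dots,A_n$ be a partition of $[N]$ into sets of size $nk$, and for each $i\in[n]$ let $S_i$ be a Latin square of order $nk$ over the alphabet $A_i$ that can be decomposed into $nk$ pairwise disjoint transversals. Let $L$ be any $N\times N$ matrix viewed as an $n\times n$ block matrix of $nk\times nk$ blocks, indexed by $(i,j)\in[n]^2$, such that for every special position $(i,j)$ of $S$, the block $(i,j)$ of $L$ equals $S_{S(i,j)}$, and for every non-special position $(i,j)$ the block $(i,j)$ is some Latin square of order $nk$ over the alphabet $A_{S(i,j)}$ (so $L$ is a Latin square of order $N$ over $[N]$). Call the positions of $L$ lying in blocks $(i,j)$ with $(i,j)$ special the special positions of $L$. Then $L$ contains a collection of $\ell nk$ pairwise disjoint transversals, each consisting only of special positions.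
   Context: A Latin square of order $m$ over an alphabet $A$ with $|A|=m$ is an $m\times m$ matrix with entries in $A$ in which every symbol appears exactly once in every row and every column. A transversal of a Latin square of order $m$ is a set of $m$ positions containing exactly one position from each row, exactly one from each column, and exactly one of each symbol. Transversals are disjoint if they share no position. $[m]=\{1,\dots,m\}$. -}

module Defs where

open import Data.Nat using (ℕ; suc; _+_; _*_; _∸_; _^_; _≤_; _<_)
open import Data.Fin using (Fin; combine; quotient)
open import Data.Fin.Subset using (Subset; _∈_; ∣_∣)
open import Data.Bool using (Bool; true; false)
open import Data.Product using (Σ; ∃; ∃!; _×_; _,_; proj₁; proj₂)
open import Data.Unit using (⊤)
open import Relation.Binary.PropositionalEquality using (_≡_; _≢_)

-- k = ⌊ b - b^(9/10) ⌋, characterised exactly (for b ≥ 1) by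
--   k ≤ b - b^(9/10) < k + 1
-- i.e. k ≤ b, b^9 ≤ (b - k)^10, and (b - (k+1))^10 < b^9 (truncated subtraction
-- handles the case b - k - 1 < 0, where the strict inequality is automatic).
IsFloorK : ℕ → ℕ → Set
IsFloorK b k = k ≤ b × (b ^ 9 ≤ (b ∸ k) ^ 10) × ((b ∸ suc k) ^ 10 < b ^ 9)

IsLatinOver : ∀ {m N} → (Fin N → Set) → (Fin m → Fin m → Fin N) → Set
IsLatinOver {m} {N} A M =
  (∀ r c → A (M r c)) ×
  (∀ (r : Fin m) (s : Fin N) → A s → ∃! _≡_ (λ c → M r c ≡ s)) ×
  (∀ (c : Fin m) (s : Fin N) → A s → ∃! _≡_ (λ r → M r c ≡ s))

Full : ∀ {N} → Fin N → Set
Full _ = ⊤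

IsTransversal : ∀ {m N} → (Fin N → Set) → (Fin m → Fin m → Fin N) →
                (Fin m → Fin m → Bool) → Set
IsTransversal {m} {N} A M T =
  (∀ r → ∃! _≡_ (λ c → T r c ≡ true)) ×
  (∀ c → ∃! _≡_ (λ r → T r c ≡ true)) ×
  (∀ (s : Fin N) → A s →
     ∃! _≡_ (λ (p : Fin m × Fin m) → T (proj₁ p) (proj₂ p) ≡ true × M (proj₁ p) (proj₂ p) ≡ s))

Disjoint : ∀ {m} → (Fin m → Fin m → Bool) → (Fin m → Fin m → Bool) → Set
Disjoint {m} T U = ∀ (r c : Fin m) → T r c ≡ true → U r c ≡ true → ⊥'
  where open import Data.Empty renaming (⊥ to ⊥')

DisjointTransversals : ∀ {m N} → (Fin N → Set) → (Fin m → Fin m → Fin N) →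
                       (t : ℕ) → (Fin t → Fin m → Fin m → Bool) → Set
DisjointTransversals A M t T =
  (∀ x → IsTransversal A M (T x)) × (∀ x y → x ≢ y → Disjoint (T x) (T y))

Decomposable : ∀ {m N} → (Fin N → Set) → (Fin m → Fin m → Fin N) → ℕ → Set
Decomposable {m} A M t =
  Σ (Fin t → Fin m → Fin m → Bool) λ T →
    DisjointTransversals A M t T × (∀ r c → ∃ λ x → T x r c ≡ true)

block : ∀ {n m} {X : Set} → (Fin (n * m) → Fin (n * m) → X) →
        Fin n → Fin n → Fin m → Fin m → X
block L i j u v = L (combine i u) (combine j v)

blockOf : ∀ {n} (m : ℕ) → Fin (n * m) → Fin n
blockOf m = quotient m

-- A transversal T of the block pattern S, together with a choice of a transversal
-- of each block lying on T, blows up to a transversal of L: rows, columns and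
-- positions of L factor as (block index, index inside the block), and a symbol s of
-- L lies in a unique alphabet A_i, so it is hit exactly once inside the unique cell
-- of T carrying the symbol i.  Blowing up the ℓ special transversals of S with the
-- x-th transversal of every S_i (x ∈ [nk]) gives ℓ·nk transversals, which are
-- disjoint because distinct special transversals are disjoint and, on a common
-- one, distinct transversals of the same S_i are disjoint.
module Submission where

open import Defs
open import Data.Nat using (ℕ; _*_; _∸_; _≤_)
open import Data.Fin using (Fin; combine; quotient; remainder; _≟_)
open import Data.Fin.Properties using (remQuot-combine; combine-remQuot; *↔×)
open import Data.Fin.Subset using (Subset; _∈_; ∣_∣)
open import Data.Bool using (Bool; true; _∧_)
open import Data.Empty using (⊥; ⊥-elim)
open import Data.Product using (Σ; ∃; ∃!; _×_; _,_; proj₁; proj₂)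
open import Data.Unit using (tt)
open import Function.Bundles using (_↔_; Inverse; mk↔ₛ′)
open import Relation.Binary.PropositionalEquality
  using (_≡_; _≢_; refl; sym; trans; cong; cong₂; subst)
open import Relation.Nullary using (¬_; yes; no)

∧≡true-split : ∀ {a b} → a ∧ b ≡ true → a ≡ true × b ≡ true
∧≡true-split {true} {true} refl = refl , refl

∧≡true-intro : ∀ {a b} → a ≡ true → b ≡ true → a ∧ b ≡ true
∧≡true-intro refl refl = refl

∃!-cong : {X : Set} {P Q : X → Set} →
          (∀ x → P x → Q x) → (∀ x → Q x → P x) → ∃! _≡_ P → ∃! _≡_ Q
∃!-cong P⇒Q Q⇒P (x , px , unique) = x , P⇒Q x px , λ {y} qy → unique (Q⇒P y qy)

∃!-↔ : {X I U : Set} (e : X ↔ (I × U)) {P : I → Set} {Q : I → U → Set} →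
       ∃! _≡_ P → (∀ i → P i → ∃! _≡_ (Q i)) →
       let open Inverse e in
       ∃! _≡_ (λ x → P (proj₁ (to x)) × Q (proj₁ (to x)) (proj₂ (to x)))
∃!-↔ e {P} {Q} (i , pᵢ , uniqueᵢ) ∃!Q with ∃!Q i pᵢ
... | u , qᵤ , uniqueᵤ = from (i , u) , holds , unique
  where
  open Inverse e
  holds : P (proj₁ (to (from (i , u)))) × Q (proj₁ (to (from (i , u)))) (proj₂ (to (from (i , u))))
  holds = subst (λ p → P (proj₁ p) × Q (proj₁ p) (proj₂ p)) (sym (strictlyInverseˡ (i , u))) (pᵢ , qᵤ)
  unique : ∀ {x} → P (proj₁ (to x)) × Q (proj₁ (to x)) (proj₂ (to x)) → from (i , u) ≡ x
  unique {x} (px , qx) = trans (cong from (cong₂ _,_ i≡ u≡)) (strictlyInverseʳ x)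
    where
    i≡ : i ≡ proj₁ (to x)
    i≡ = uniqueᵢ px
    u≡ : u ≡ proj₂ (to x)
    u≡ = uniqueᵤ (subst (λ j → Q j (proj₂ (to x))) (sym i≡) qx)

IsTransversal-resp-≗ : ∀ {m N} {A : Fin N → Set} {M M' : Fin m → Fin m → Fin N}
                         {T : Fin m → Fin m → Bool} →
                       (∀ u v → M u v ≡ M' u v) → IsTransversal A M T → IsTransversal A M' T
IsTransversal-resp-≗ M≗M' (rows , columns , symbols) =
  rows , columns , λ s s∈A → ∃!-cong (λ p (t , e) → t , trans (sym (M≗M' _ _)) e)
                                     (λ p (t , e) → t , trans (M≗M' _ _) e)
                                     (symbols s s∈A)

module _ {n m : ℕ} where

  position↔blockPosition : (Fin (n * m) × Fin (n * m)) ↔ ((Fin n × Fin n) × (Fin m × Fin m))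
  position↔blockPosition = mk↔ₛ′
    (λ (r , c) → (quotient m r , quotient m c) , (remainder {n} m r , remainder {n} m c))
    (λ ((i , j) , (u , v)) → combine i u , combine j v)
    (λ ((i , j) , (u , v)) → cong₂ (λ p q → (proj₁ p , proj₁ q) , (proj₂ p , proj₂ q))
                                   (remQuot-combine i u) (remQuot-combine j v))
    (λ (r , c) → cong₂ _,_ (combine-remQuot {n} m r) (combine-remQuot {n} m c))

  block-quotient-remainder : ∀ {X : Set} (L : Fin (n * m) → Fin (n * m) → X) r c →
    block {n} {m} L (quotient m r) (quotient m c) (remainder {n} m r) (remainder {n} m c) ≡ L r c
  block-quotient-remainder L r c = cong₂ L (combine-remQuot {n} m r) (combine-remQuot {n} m c)

  blowUp : (Fin n → Fin n → Bool) → (Fin n → Fin n → Fin m → Fin m → Bool) →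
           Fin (n * m) → Fin (n * m) → Bool
  blowUp T D r c = T (quotient m r) (quotient m c)
                 ∧ D (quotient m r) (quotient m c) (remainder {n} m r) (remainder {n} m c)

  blowUp-disjointᵀ : ∀ {T T' D D'} → Disjoint T T' → Disjoint (blowUp T D) (blowUp T' D')
  blowUp-disjointᵀ T#T' r c e e' =
    T#T' _ _ (proj₁ (∧≡true-split e)) (proj₁ (∧≡true-split e'))

  blowUp-disjointᴰ : ∀ {T T' D D'} → (∀ i j → Disjoint (D i j) (D' i j)) →
                     Disjoint (blowUp T D) (blowUp T' D')
  blowUp-disjointᴰ D#D' r c e e' =
    D#D' _ _ _ _ (proj₂ (∧≡true-split e)) (proj₂ (∧≡true-split e'))

  module _ {N : ℕ} (S : Fin n → Fin n → Fin n) (A : Fin n → Fin N → Set)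
           (partition : ∀ s → ∃! _≡_ (λ i → A i s))
           (L : Fin (n * m) → Fin (n * m) → Fin N) where

    blowUp-transversal :
      ∀ {T D} → IsTransversal Full S T →
      (∀ i j → T i j ≡ true → ∀ u v → A (S i j) (block {n} {m} L i j u v)) →
      (∀ i j → T i j ≡ true → IsTransversal (A (S i j)) (block {n} {m} L i j) (D i j)) →
      IsTransversal Full L (blowUp T D)
    blowUp-transversal {T} {D} (rowsᵀ , columnsᵀ , symbolsᵀ) blocksOver inner =
      rows , columns , λ s _ → symbols s
      where
      rows : ∀ r → ∃! _≡_ (λ c → blowUp T D r c ≡ true)
      rows r = ∃!-cong (λ c (t , d) → ∧≡true-intro t d) (λ c → ∧≡true-split)
        (∃!-↔ *↔× (rowsᵀ (quotient m r))
                  (λ j t → proj₁ (inner _ j t) (remainder {n} m r)))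

      columns : ∀ c → ∃! _≡_ (λ r → blowUp T D r c ≡ true)
      columns c = ∃!-cong (λ r (t , d) → ∧≡true-intro t d) (λ r → ∧≡true-split)
        (∃!-↔ *↔× (columnsᵀ (quotient m c))
                  (λ i t → proj₁ (proj₂ (inner i _ t)) (remainder {n} m c)))

      symbols : ∀ s → ∃! _≡_ (λ (p : Fin (n * m) × Fin (n * m)) →
                  blowUp T D (proj₁ p) (proj₂ p) ≡ true × L (proj₁ p) (proj₂ p) ≡ s)
      symbols s with partition s
      ... | a , s∈Aₐ , uniqueₐ =
        ∃!-cong (λ (r , c) ((t , S≡a) , (d , e)) →
                   ∧≡true-intro t d , trans (sym (block-quotient-remainder L r c)) e)
                (λ (r , c) (e , L≡s) →
                   let t , d = ∧≡true-split e
                       e' = trans (block-quotient-remainder L r c) L≡s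
                   in (t , sym (uniqueₐ (subst (A _) e' (blocksOver _ _ t _ _)))) , (d , e'))
                (∃!-↔ position↔blockPosition (symbolsᵀ a tt)
                      (λ (i , j) (t , S≡a) →
                         proj₂ (proj₂ (inner i j t)) s (subst (λ b → A b s) (sym S≡a) s∈Aₐ)))

    -- Indices y ∈ Fin (ℓ * p) encode pairs (t , x) = (quotient y , remainder y).
    blowUpFamily-disjointTransversals :
      ∀ {ℓ p} (Tsp : Fin ℓ → Fin n → Fin n → Bool) → DisjointTransversals Full S ℓ Tsp →
      (Si : Fin n → Fin m → Fin m → Fin N) → (∀ i u v → A i (Si i u v)) →
      (D : Fin n → Fin p → Fin m → Fin m → Bool) → (∀ i → DisjointTransversals (A i) (Si i) p (D i)) →
      (∀ i j → (∃ λ t → Tsp t i j ≡ true) → ∀ u v → block {n} {m} L i j u v ≡ Si (S i j) u v) →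
      DisjointTransversals Full L (ℓ * p)
        (λ y → blowUp (Tsp (quotient p y)) (λ i j → D (S i j) (remainder {ℓ} p y)))
    blowUpFamily-disjointTransversals {ℓ} {p} Tsp (transversalsᵀ , disjointᵀ) Si Si-over D
                                      D-transversals special =
      transversal , disjoint
      where
      family : Fin (ℓ * p) → Fin (n * m) → Fin (n * m) → Bool
      family y = blowUp (Tsp (quotient p y)) (λ i j → D (S i j) (remainder {ℓ} p y))

      transversal : ∀ y → IsTransversal Full L (family y)
      transversal y = blowUp-transversal (transversalsᵀ t)
        (λ i j tᵢⱼ u v → subst (A (S i j)) (sym (special i j (t , tᵢⱼ) u v)) (Si-over (S i j) u v))
        (λ i j tᵢⱼ → IsTransversal-resp-≗ (λ u v → sym (special i j (t , tᵢⱼ) u v))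
                                          (proj₁ (D-transversals (S i j)) (remainder {ℓ} p y)))
        where
        t : Fin ℓ
        t = quotient p y

      disjoint : ∀ y y' → y ≢ y' → Disjoint (family y) (family y')
      disjoint y y' y≢y' = disjointAt (quotient p y) (remainder {ℓ} p y) (quotient p y') (remainder {ℓ} p y')
        λ t≡t' x≡x' → y≢y' (trans (sym (combine-remQuot {ℓ} p y))
                                  (trans (cong₂ combine t≡t' x≡x') (combine-remQuot {ℓ} p y')))
        where
        disjointAt : ∀ t x t' x' → (t ≡ t' → x ≡ x' → ⊥) →
                     Disjoint (blowUp (Tsp t) (λ i j → D (S i j) x)) (blowUp (Tsp t') (λ i j → D (S i j) x'))
        disjointAt t x t' x' distinct with t ≟ t' | x ≟ x'
        ... | no t≢t' | _ = blowUp-disjointᵀ {D = λ i j → D (S i j) x} {D' = λ i j → D (S i j) x'}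
                                              (disjointᵀ _ _ t≢t')
        ... | yes _ | no x≢x' = blowUp-disjointᴰ {T = Tsp t} {T' = Tsp t'}
                                                 (λ i j → proj₂ (D-transversals (S i j)) _ _ x≢x')
        ... | yes t≡t' | yes x≡x' = ⊥-elim (distinct t≡t' x≡x')

mainTheorem2 :
  (b k : ℕ) → 3 ≤ b → IsFloorK b k →
  let n = b * b
      m = n * k
      N = n * m
      ℓ = n ∸ b * k
  in (S : Fin n → Fin n → Fin n) → IsLatinOver Full S →
     (Tsp : Fin ℓ → Fin n → Fin n → Bool) → DisjointTransversals Full S ℓ Tsp →
     (A : Fin n → Subset N) →
     (∀ (x : Fin N) → ∃! _≡_ (λ i → x ∈ A i)) →
     (∀ i → ∣ A i ∣ ≡ m) →
     (Si : Fin n → Fin m → Fin m → Fin N) →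
     (∀ i → IsLatinOver (λ x → x ∈ A i) (Si i)) →
     (∀ i → Decomposable (λ x → x ∈ A i) (Si i) m) →
     (L : Fin N → Fin N → Fin N) →
     (∀ i j → (∃ λ t → Tsp t i j ≡ true) →
        ∀ u v → block {n} {m} L i j u v ≡ Si (S i j) u v) →
     (∀ i j → ¬ (∃ λ t → Tsp t i j ≡ true) →
        IsLatinOver (λ x → x ∈ A (S i j)) (block {n} {m} L i j)) →
     Σ (Fin (ℓ * m) → Fin N → Fin N → Bool) λ T →
       DisjointTransversals Full L (ℓ * m) T ×
       (∀ x r c → T x r c ≡ true →
          ∃ λ t → Tsp t (blockOf {n} m r) (blockOf {n} m c) ≡ true)
mainTheorem2 b k _ _ S _ Tsp Tsp-transversals A partition _ Si Si-latin Si-decomposable L special _ =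
  _ , blowUpFamily-disjointTransversals S (λ i x → x ∈ A i) partition L Tsp Tsp-transversals
        Si (λ i → proj₁ (Si-latin i)) (λ i → proj₁ (Si-decomposable i))
        (λ i → proj₁ (proj₂ (Si-decomposable i))) special
    , λ y r c e → quotient (b * b * k) y , proj₁ (∧≡true-split e)
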